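{- Let $k\ge2$, let $n\ge1$ with $n\not\equiv2\pmod4$, and let $D=\{d_1<d_2<\dots<d_{k-1}\}\subseteq[n-1]$; set $d_0=0$, $d_k=n$. For $\tau\in\mathcal C_n$ with $\mathrm{Des}(\tau)\subseteq D$, choose $\pi\in\mathcal S_n$ with $\hat\pi=\tau$, let $s=(s_1\dots s_n)^\infty$ where $s_i=t$ whenever $d_t<\pi_i\le d_{t+1}$, let $\pi'=\Pi_{ -^k}(s)$, and set $\delta(\tau)=\widehat{\pi'}$. Then $\delta$ is a bijection between $\{\tau\in\mathcal C_n:\mathrm{Des}(\tau)\subseteq D\}$ and $\{\tau\in\mathcal C_n:\mathrm{Asc}(\tau)\subseteq D\}$.
   Context: $\mathcal C_n$ is the set of cyclic permutations (single $n$-cycles) in $\mathcal S_n$. For $\tau\in\mathcal S_n$ in one-line notation, $\mathrm{Des}(\tau)=\{i\in[n-1]:\tau_i>\tau_{i+1}\}$ and $\mathrm{Asc}(\tau)=\{i\in[n-1]:\tau_i<\tau_{i+1}\}$. For $\pi\in\mathcal S_n$, $\hat\pi$ is the cyclic permutation $(\pi_1,\dots,\pi_n)$ in cycle notation, i.e. $\hat\pi_{\pi_i}=\pi_{i+1}$ with $\pi_{n+1}=\pi_1$; every $\tau\in\mathcal C_n$ equals $\hat\pi$ for some $\pi$ (unique up to cyclic rotation). For infinite words over $\{0,\dots,k-1\}$, the order $\prec_{ -^k}$ is: for $s\ne t$ with $j$ the first index where they differ, $s\prec_{ -^k}t$ iff ($j-1$ even and $s_j<t_j$) or ($j-1$ odd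 and $s_j>t_j$). For a word $s=(s_1\dots s_n)^\infty$ with $s_1\dots s_n$ primitive (not a power of a shorter word), $\Pi_{ -^k}(s)\in\mathcal S_n$ is the permutation with $\Pi_{ -^k}(s)_i<\Pi_{ -^k}(s)_j$ iff $s_is_{i+1}\dots\prec_{ -^k}s_js_{j+1}\dots$. -}

module Defs where

open import Data.Nat as ℕ using (ℕ; zero; suc; _%_)
open import Data.Nat.DivMod using (m%n<n)
open import Data.Fin as Fin using (Fin; toℕ; fromℕ; fromℕ<; inject₁)
open import Data.Vec using (Vec; lookup)
open import Data.Product using (Σ; ∃; _×_)
open import Data.Sum using (_⊎_)
open import Relation.Binary.PropositionalEquality using (_≡_)

-- Conventions: a permutation of [n] is a vector  τ : Vec (Fin n) n ;
-- position p (0-based, Fin n) stands for position p+1, value v : Fin n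
-- stands for the value toℕ v + 1.

IsPerm : ∀ {n} → Vec (Fin n) n → Set
IsPerm {n} τ = ∀ (i j : Fin n) → lookup τ i ≡ lookup τ j → i ≡ j

iter : ∀ {A : Set} → (A → A) → ℕ → A → A
iter f zero x = x
iter f (suc m) x = f (iter f m x)

IsCyclic : ∀ {n} → Vec (Fin n) n → Set
IsCyclic {n} τ = IsPerm τ × (∀ (i j : Fin n) → ∃ λ m → iter (lookup τ) m i ≡ j)

csuc : ∀ {n} → Fin n → Fin n
csuc {suc m} i = fromℕ< (m%n<n (suc (toℕ i)) (suc m))

IsHat : ∀ {n} → Vec (Fin n) n → Vec (Fin n) n → Set
IsHat {n} π τ = ∀ (i : Fin n) → lookup τ (lookup π i) ≡ lookup π (csuc i)

-- The set D = {d_1 < ... < d_{k-1}} is encoded by d : Fin (suc k) → ℕ,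
-- strictly increasing with d_0 = 0 and d_k = n.
StrictIncr : ∀ {k} → (Fin (suc k) → ℕ) → Set
StrictIncr {k} d = ∀ (a b : Fin (suc k)) → toℕ a ℕ.< toℕ b → d a ℕ.< d b

InD : ∀ {k} → (Fin (suc k) → ℕ) → ℕ → Set
InD {k} d x = ∃ λ (t : Fin (suc k)) → 0 ℕ.< toℕ t × toℕ t ℕ.< k × d t ≡ x

-- Des(τ) ⊆ D : whenever positions i, i+1 (1-based i = toℕ p + 1) have τ_i > τ_{i+1}
DesIn : ∀ {n k} → (Fin (suc k) → ℕ) → Vec (Fin n) n → Set
DesIn {n} d τ = ∀ (p q : Fin n) → toℕ q ≡ suc (toℕ p) →
  lookup τ q Fin.< lookup τ p → InD d (suc (toℕ p))

AscIn : ∀ {n k} → (Fin (suc k) → ℕ) → Vec (Fin n) n → Set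
AscIn {n} d τ = ∀ (p q : Fin n) → toℕ q ≡ suc (toℕ p) →
  lookup τ p Fin.< lookup τ q → InD d (suc (toℕ p))

Coding : ∀ {n k} → (Fin (suc k) → ℕ) → Vec (Fin n) n → (Fin n → Fin k) → Set
Coding {n} d π s = ∀ (i : Fin n) →
  d (inject₁ (s i)) ℕ.< suc (toℕ (lookup π i)) × suc (toℕ (lookup π i)) ℕ.≤ d (Fin.suc (s i))

-- the suffix s_i s_{i+1} ... of the infinite word (s_1 ... s_n)^∞
-- (i a 0-based position, the suffix indexed from 0; letters taken mod n)
suffix : ∀ {n k} → (Fin n → Fin k) → Fin n → ℕ → Fin k
suffix {suc m} s i j = s (fromℕ< (m%n<n (toℕ i ℕ.+ j) (suc m)))

-- the order ≺_{-^k} on infinite words (0-based index j: 1-based index j+1,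
-- so "j-1 even" in the 1-based convention is "j even" here)
_≺_ : ∀ {k} → (ℕ → Fin k) → (ℕ → Fin k) → Set
u ≺ w = ∃ λ j → (∀ l → l ℕ.< j → u l ≡ w l) ×
  ((j % 2 ≡ 0 × u j Fin.< w j) ⊎ (j % 2 ≡ 1 × w j Fin.< u j))

-- π' = Π_{-^k}(s) : π'_i < π'_j iff suffix_i ≺ suffix_j
-- (existence of such π' forces s_1…s_n to be primitive)
IsΠ : ∀ {n k} → (Fin n → Fin k) → Vec (Fin n) n → Set
IsΠ {n} s π' = IsPerm π' × (∀ (i j : Fin n) →
  (lookup π' i Fin.< lookup π' j → suffix s i ≺ suffix s j) ×
  (suffix s i ≺ suffix s j → lookup π' i Fin.< lookup π' j))

-- A permutation with Des ⊆ D is increasing on every block (d_t, d_{t+1}] of values, one with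
-- Asc ⊆ D decreasing on every block. For a cyclic permutation f, the itinerary of a point x is the
-- word of blocks visited by x, f x, f² x, …; the word s of the statement is the itinerary of π₁.
-- Monotonicity on blocks forces distinct points to have itineraries differing within n letters
-- (for decreasing f this needs n ≢ 2 mod 4), so ranking the points by their itineraries, in the
-- alternating order ≺ or in the lexicographic order, is a bijection ρ. It preserves blocks, since
-- the first letter is compared first, and ρ f ρ⁻¹ has the same itineraries as f. Ranked by ≺, an
-- increasing-on-blocks f becomes decreasing on blocks; ranked lexicographically, a decreasing one
-- becomes increasing. Ranking the result back in the other order, the composite of the two
-- rankings is strictly increasing, hence the identity, so the two conjugations are inverse.

module Submission where

open import Defs
open import Data.Nat as ℕ
  using (ℕ; zero; suc; _+_; _*_; _∸_; _≤_; _<_; z≤n; s≤s; s≤s⁻¹; _%_; _/_; NonZero; >-nonZero⁻¹; _<?_; _≤?_)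
open import Data.Nat.Properties
open import Data.Nat.DivMod using (m≡m%n+[m/n]*n; m%n<n; m%n%n≡m%n; m<n⇒m%n≡m; %-distribˡ-+; m∣n⇒o%n%m≡o%m)
open import Data.Nat.Divisibility using (_∣_; divides; divides-refl; m%n≡0⇒n∣m; n∣m⇒m%n≡0; ∣-trans)
open import Data.Fin as Fin using (Fin; toℕ; fromℕ<; inject₁; punchOut)
open import Data.Fin.Properties
  using (toℕ-injective; toℕ-fromℕ<; toℕ<n; toℕ-inject₁; toℕ-fromℕ; any?; punchOut-injective; injective⇒≤; pigeonhole)
  renaming (_≟_ to _≟ᶠ_)
open import Data.Product using (Σ; ∃; _×_; _,_; proj₁; proj₂)
open import Data.Empty using (⊥; ⊥-elim)
open import Data.Unit using (⊤; tt)
open import Data.Sum using (_⊎_; inj₁; inj₂; [_,_]′)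
open import Function using (_∘_)
open import Data.Vec using (Vec; lookup; tabulate)
open import Data.Vec.Properties using (lookup∘tabulate; tabulate∘lookup; tabulate-cong)
open import Data.Bool using (Bool; true; false; not; if_then_else_)
open import Level using (0ℓ)
open import Relation.Binary using (Rel; Transitive; Irreflexive; tri<; tri≈; tri>)
open import Relation.Binary.PropositionalEquality
open import Relation.Nullary using (Dec; yes; no; ¬_; does)
open import Relation.Unary using (Pred; Decidable; _⊆′_)

module _ {A : Set} (f : A → A) where

  iter-+ : ∀ a b x → iter f (a + b) x ≡ iter f a (iter f b x)
  iter-+ zero b x = refl
  iter-+ (suc a) b x = cong f (iter-+ a b x)

  iter-commute : ∀ a x → iter f a (f x) ≡ f (iter f a x)
  iter-commute zero x = refl
  iter-commute (suc a) x = cong f (iter-commute a x)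

  iter-injective : (∀ x y → f x ≡ f y → x ≡ y) → ∀ a x y → iter f a x ≡ iter f a y → x ≡ y
  iter-injective inj zero x y e = e
  iter-injective inj (suc a) x y e = iter-injective inj a x y (inj _ _ e)

  iter-iter : ∀ q a x → iter (iter f q) a x ≡ iter f (a * q) x
  iter-iter q zero x = refl
  iter-iter q (suc a) x = trans (cong (iter f q) (iter-iter q a x)) (sym (iter-+ q (a * q) x))

  module _ (P : ℕ) {x : A} (periodic : iter f P x ≡ x) where

    iter-period-* : ∀ a → iter f (a * P) x ≡ x
    iter-period-* zero = refl
    iter-period-* (suc a) = trans (iter-+ P (a * P) x) (trans (cong (iter f P) (iter-period-* a)) periodic)

    iter-period-% : .{{_ : NonZero P}} → ∀ j → iter f j x ≡ iter f (j % P) x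
    iter-period-% j = begin
        iter f j x                           ≡⟨ cong (λ t → iter f t x) (m≡m%n+[m/n]*n j P) ⟩
        iter f (j % P + (j / P) * P) x       ≡⟨ iter-+ (j % P) ((j / P) * P) x ⟩
        iter f (j % P) (iter f ((j / P) * P) x) ≡⟨ cong (iter f (j % P)) (iter-period-* (j / P)) ⟩
        iter f (j % P) x                     ∎
      where open ≡-Reasoning

iter-natural : ∀ {A B : Set} (f : A → A) (g : B → B) (h : A → B) →
  (∀ y → h (f y) ≡ g (h y)) → ∀ a x → h (iter f a x) ≡ iter g a (h x)
iter-natural f g h e zero x = refl
iter-natural f g h e (suc a) x = trans (e _) (cong g (iter-natural f g h e a x))

iter-cong : ∀ {A : Set} {f g : A → A} → f ≗ g → ∀ a x → iter f a x ≡ iter g a x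
iter-cong e zero x = refl
iter-cong {g = g} e (suc a) x = trans (e _) (cong g (iter-cong e a x))

strictChain-noReturn : ∀ {A : Set} (_≺_ : Rel A 0ℓ) → Transitive _≺_ → Irreflexive _≡_ _≺_ →
  (h : ℕ → A) → (∀ a → h a ≺ h (suc a)) → ∀ {N} → 0 < N → h N ≢ h 0
strictChain-noReturn _≺_ ≺-trans ≺-irrefl h step {suc N} _ eq = ≺-irrefl (sym eq) (above N)
  where
  above : ∀ a → h 0 ≺ h (suc a)
  above zero = step 0
  above (suc a) = ≺-trans (above a) (step (suc a))

count : ∀ {N} (P : Pred (Fin N) 0ℓ) → Decidable P → ℕ
count {zero} P P? = 0
count {suc N} P P? = (if does (P? Fin.zero) then 1 else 0) + count (λ y → P (Fin.suc y)) (λ y → P? (Fin.suc y))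

count-mono : ∀ {N} (P Q : Pred (Fin N) 0ℓ) P? Q? → P ⊆′ Q → count P P? ≤ count Q Q?
count-mono {zero} P Q P? Q? P⊆Q = z≤n
count-mono {suc N} P Q P? Q? P⊆Q with P? Fin.zero | Q? Fin.zero
... | yes p | yes q = s≤s (count-mono _ _ _ _ (λ y → P⊆Q (Fin.suc y)))
... | yes p | no ¬q = ⊥-elim (¬q (P⊆Q _ p))
... | no ¬p | yes q = m≤n⇒m≤1+n (count-mono _ _ _ _ (λ y → P⊆Q (Fin.suc y)))
... | no ¬p | no ¬q = count-mono _ _ _ _ (λ y → P⊆Q (Fin.suc y))

count-strict : ∀ {N} (P Q : Pred (Fin N) 0ℓ) P? Q? → P ⊆′ Q →
  (z : Fin N) → Q z → ¬ P z → count P P? < count Q Q?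
count-strict {suc N} P Q P? Q? P⊆Q Fin.zero qz ¬pz with P? Fin.zero | Q? Fin.zero
... | yes p | _ = ⊥-elim (¬pz p)
... | no _ | yes q = s≤s (count-mono _ _ _ _ (λ y → P⊆Q (Fin.suc y)))
... | no _ | no ¬q = ⊥-elim (¬q qz)
count-strict {suc N} P Q P? Q? P⊆Q (Fin.suc z) qz ¬pz with P? Fin.zero | Q? Fin.zero
... | yes p | yes q = s≤s (count-strict _ _ _ _ (λ y → P⊆Q (Fin.suc y)) z qz ¬pz)
... | yes p | no ¬q = ⊥-elim (¬q (P⊆Q _ p))
... | no ¬p | yes q = m≤n⇒m≤1+n (count-strict _ _ _ _ (λ y → P⊆Q (Fin.suc y)) z qz ¬pz)
... | no ¬p | no ¬q = count-strict _ _ _ _ (λ y → P⊆Q (Fin.suc y)) z qz ¬pz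

count-cong : ∀ {N} (P Q : Pred (Fin N) 0ℓ) P? Q? → P ⊆′ Q → Q ⊆′ P → count P P? ≡ count Q Q?
count-cong P Q P? Q? P⊆Q Q⊆P = ≤-antisym (count-mono P Q P? Q? P⊆Q) (count-mono Q P Q? P? Q⊆P)

count-all : ∀ {N} (P : Pred (Fin N) 0ℓ) P? → (∀ y → P y) → count P P? ≡ N
count-all {zero} P P? all = refl
count-all {suc N} P P? all with P? Fin.zero
... | yes _ = cong suc (count-all _ _ (λ y → all (Fin.suc y)))
... | no ¬p = ⊥-elim (¬p (all _))

count-none : ∀ {N} (P : Pred (Fin N) 0ℓ) P? → (∀ y → ¬ P y) → count P P? ≡ 0
count-none {zero} P P? none = refl
count-none {suc N} P P? none with P? Fin.zero
... | yes p = ⊥-elim (none _ p)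
... | no ¬p = count-none _ _ (λ y → none (Fin.suc y))

count-toℕ< : ∀ {N} a → a ≤ N → count (λ (y : Fin N) → toℕ y < a) (λ y → toℕ y <? a) ≡ a
count-toℕ< {zero} zero _ = refl
count-toℕ< {suc N} zero _ = count-none (λ (y : Fin (suc N)) → toℕ y < 0) (λ y → toℕ y <? 0) (λ y ())
count-toℕ< {suc N} (suc a) (s≤s a≤N) = cong suc (trans
  (count-cong (λ (y : Fin N) → suc (toℕ y) < suc a) (λ y → toℕ y < a) (λ y → suc (toℕ y) <? suc a) (λ y → toℕ y <? a)
    (λ y → s≤s⁻¹) (λ y → s≤s))
  (count-toℕ< a a≤N))

Injectiveᶠ : ∀ {n} → (Fin n → Fin n) → Set
Injectiveᶠ h = ∀ x y → h x ≡ h y → x ≡ y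

injective⇒surjective : ∀ {n} (h : Fin n → Fin n) → Injectiveᶠ h → ∀ v → ∃ λ x → h x ≡ v
injective⇒surjective {zero} h inj ()
injective⇒surjective {suc m} h inj v with any? (λ x → h x ≟ᶠ v)
... | yes found = found
... | no ¬found = ⊥-elim (n≮n m (injective⇒≤ {f = missing-v} missing-v-injective))
  where
  missing-v : Fin (suc m) → Fin m
  missing-v x = punchOut {i = v} {j = h x} (λ e → ¬found (x , sym e))
  missing-v-injective : ∀ {x y} → missing-v x ≡ missing-v y → x ≡ y
  missing-v-injective {x} {y} e = inj x y (punchOut-injective {i = v} (λ e → ¬found (x , sym e)) (λ e → ¬found (y , sym e)) e)

-- total; a right inverse of h whenever h is injective
invert : ∀ {n} → (Fin n → Fin n) → Fin n → Fin n
invert h v with any? (λ x → h x ≟ᶠ v)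
... | yes (x , _) = x
... | no _ = v

invert-section : ∀ {n} (h : Fin n → Fin n) → Injectiveᶠ h → ∀ v → h (invert h v) ≡ v
invert-section h inj v with any? (λ x → h x ≟ᶠ v)
... | yes (x , hx≡v) = hx≡v
... | no ¬found = ⊥-elim (¬found (injective⇒surjective h inj v))

invert-retraction : ∀ {n} (h : Fin n → Fin n) → Injectiveᶠ h → ∀ x → invert h (h x) ≡ x
invert-retraction h inj x = inj _ _ (invert-section h inj (h x))

StrictlyIncreasing : ∀ {n} → (Fin n → Fin n) → Set
StrictlyIncreasing h = ∀ x y → x Fin.< y → h x Fin.< h y

module _ {n} (h : Fin n → Fin n) (mono : StrictlyIncreasing h) where

  strictlyIncreasing⇒injective : Injectiveᶠ h
  strictlyIncreasing⇒injective x y hx≡hy with <-cmp (toℕ x) (toℕ y)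
  ... | tri< x<y _ _ = ⊥-elim (<-irrefl (cong toℕ hx≡hy) (mono x y x<y))
  ... | tri≈ _ x≡y _ = toℕ-injective x≡y
  ... | tri> _ _ y<x = ⊥-elim (<-irrefl (cong toℕ (sym hx≡hy)) (mono y x y<x))

  strictlyIncreasing⇒inflationary : ∀ x → toℕ x ≤ toℕ (h x)
  strictlyIncreasing⇒inflationary x = go (toℕ x) x refl
    where
    go : ∀ a x → toℕ x ≡ a → a ≤ toℕ (h x)
    go zero x _ = z≤n
    go (suc a) x x≡1+a = ≤-trans (s≤s (go a y (toℕ-fromℕ< a<n))) (mono y x y<x)
      where
      a<n : a < n
      a<n = ≤-trans (n≤1+n (suc a)) (subst (_< n) x≡1+a (toℕ<n x))
      y = fromℕ< a<n
      y<x : y Fin.< x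
      y<x = subst₂ _<_ (sym (toℕ-fromℕ< a<n)) (sym x≡1+a) ≤-refl

-- the inverse of h is again strictly increasing, hence also inflationary
strictlyIncreasing⇒≗id : ∀ {n} (h : Fin n → Fin n) → StrictlyIncreasing h → ∀ x → h x ≡ x
strictlyIncreasing⇒≗id h mono x = toℕ-injective (≤-antisym deflationary (strictlyIncreasing⇒inflationary h mono x))
  where
  inj = strictlyIncreasing⇒injective h mono
  h⁻¹ = invert h
  h⁻¹-injective : ∀ {v w} → h⁻¹ v ≡ h⁻¹ w → v ≡ w
  h⁻¹-injective {v} {w} eq = trans (sym (invert-section h inj v)) (trans (cong h eq) (invert-section h inj w))
  h⁻¹-mono : StrictlyIncreasing h⁻¹
  h⁻¹-mono v w v<w with <-cmp (toℕ (h⁻¹ v)) (toℕ (h⁻¹ w))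
  ... | tri< lt _ _ = lt
  ... | tri≈ _ eq _ = ⊥-elim (<-irrefl (cong toℕ (h⁻¹-injective (toℕ-injective eq))) v<w)
  ... | tri> _ _ gt = ⊥-elim (<-asym v<w (subst₂ _<_ (cong toℕ (invert-section h inj w)) (cong toℕ (invert-section h inj v)) (mono _ _ gt)))
  deflationary : toℕ (h x) ≤ toℕ x
  deflationary = subst (toℕ (h x) ≤_) (cong toℕ (invert-retraction h inj x)) (strictlyIncreasing⇒inflationary h⁻¹ h⁻¹-mono (h x))

%2-cases : ∀ q → q % 2 ≡ 0 ⊎ q % 2 ≡ 1
%2-cases q with q % 2 | m%n<n q 2
... | 0 | _ = inj₁ refl
... | 1 | _ = inj₂ refl
... | suc (suc _) | s≤s (s≤s ())

odd+odd-even : ∀ p q → p % 2 ≡ 1 → q % 2 ≡ 1 → 2 ∣ p + q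
odd+odd-even p q p-odd q-odd = m%n≡0⇒n∣m (p + q) 2
  (trans (%-distribˡ-+ p q 2) (cong₂ (λ a b → (a + b) % 2) p-odd q-odd))

%4≢2⇒odd⊎4∣ : ∀ n → n % 4 ≢ 2 → n % 2 ≡ 1 ⊎ 4 ∣ n
%4≢2⇒odd⊎4∣ n n%4≢2 = cases (n % 4) refl (m%n<n n 4)
  where
  n%2≡n%4%2 : n % 2 ≡ (n % 4) % 2
  n%2≡n%4%2 = sym (m∣n⇒o%n%m≡o%m 2 4 n (divides 2 refl))
  cases : ∀ r → n % 4 ≡ r → r < 4 → n % 2 ≡ 1 ⊎ 4 ∣ n
  cases 0 eq _ = inj₂ (m%n≡0⇒n∣m n 4 eq)
  cases 1 eq _ = inj₁ (trans n%2≡n%4%2 (cong (_% 2) eq))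
  cases 2 eq _ = ⊥-elim (n%4≢2 eq)
  cases 3 eq _ = inj₁ (trans n%2≡n%4%2 (cong (_% 2) eq))
  cases (suc (suc (suc (suc _)))) _ (s≤s (s≤s (s≤s (s≤s ()))))

4∣2*odd⇒⊥ : ∀ q → q % 2 ≡ 1 → 4 ∣ q * 2 → ⊥
4∣2*odd⇒⊥ q q-odd (divides t q*2≡t*4) = 0≢1+n (trans (sym (n∣m⇒m%n≡0 q 2 (divides t q≡t*2))) q-odd)
  where
  q≡t*2 : q ≡ t * 2
  q≡t*2 = *-cancelʳ-≡ q (t * 2) 2 (trans q*2≡t*4 (sym (*-assoc t 2 2)))

[1+m%n]%n≡[1+m]%n : ∀ m n .{{_ : NonZero n}} → suc (m % n) % n ≡ suc m % n
[1+m%n]%n≡[1+m]%n m n = begin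
  (1 + m % n) % n          ≡⟨ %-distribˡ-+ 1 (m % n) n ⟩
  (1 % n + m % n % n) % n  ≡⟨ cong (λ t → (1 % n + t) % n) (m%n%n≡m%n m n) ⟩
  (1 % n + m % n) % n      ≡⟨ %-distribˡ-+ 1 m n ⟨
  (1 + m) % n              ∎
  where open ≡-Reasoning

-- Cyclic maps

Cyclic : ∀ {n} → (Fin n → Fin n) → Set
Cyclic f = Injectiveᶠ f × (∀ i j → ∃ λ a → iter f a i ≡ j)

cyclic-cong : ∀ {n} {f g : Fin n → Fin n} → f ≗ g → Cyclic g → Cyclic f
cyclic-cong f≗g (inj , reach) = (λ a b eq → inj a b (trans (sym (f≗g a)) (trans eq (f≗g b)))) ,
  (λ a b → proj₁ (reach a b) , trans (iter-cong f≗g (proj₁ (reach a b)) a) (proj₂ (reach a b)))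

module CyclicMap {n} .{{_ : NonZero n}} (f : Fin n → Fin n) (cyclic : Cyclic f) where

  -- x, f x, …, f^p x already meet every point of Fin n
  return-time-≥ : ∀ x p → iter f (suc p) x ≡ x → n ≤ suc p
  return-time-≥ x p returns = injective⇒≤ {f = time} time-injective
    where
    steps : Fin n → ℕ
    steps y = proj₁ (proj₂ cyclic x y)
    time : Fin n → Fin (suc p)
    time y = fromℕ< (m%n<n (steps y) (suc p))
    reached : ∀ y → iter f (toℕ (time y)) x ≡ y
    reached y = begin
      iter f (toℕ (time y)) x   ≡⟨ cong (λ t → iter f t x) (toℕ-fromℕ< (m%n<n (steps y) (suc p))) ⟩
      iter f (steps y % suc p) x ≡⟨ iter-period-% f (suc p) returns (steps y) ⟨
      iter f (steps y) x        ≡⟨ proj₂ (proj₂ cyclic x y) ⟩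
      y                         ∎
      where open ≡-Reasoning
    time-injective : ∀ {y z} → time y ≡ time z → y ≡ z
    time-injective {y} {z} eq = trans (sym (reached y)) (trans (cong (λ t → iter f (toℕ t) x) eq) (reached z))

  iter-n : ∀ x → iter f n x ≡ x
  iter-n x with pigeonhole (n<1+n n) (λ (a : Fin (suc n)) → iter f (toℕ a) x)
  ... | i , j , i<j , fⁱx≡fʲx = returnsAfter (toℕ j ∸ toℕ i) (sym (m+[n∸m]≡n (<⇒≤ i<j)))
      (≤-trans (m∸n≤m (toℕ j) (toℕ i)) (s≤s⁻¹ (toℕ<n j)))
    where
    returnsAfter : ∀ p → toℕ j ≡ toℕ i + p → p ≤ n → iter f n x ≡ x
    returnsAfter zero j≡i _ = ⊥-elim (<-irrefl (trans (sym (+-identityʳ _)) (sym j≡i)) i<j)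
    returnsAfter (suc p) j≡i+p p≤n = subst (λ t → iter f t x ≡ x) (≤-antisym p≤n (return-time-≥ x p returns)) returns
      where
      returns : iter f (suc p) x ≡ x
      returns = sym (iter-injective f (proj₁ cyclic) (toℕ i) x (iter f (suc p) x)
        (trans fⁱx≡fʲx (trans (cong (λ t → iter f t x) j≡i+p) (iter-+ f (toℕ i) (suc p) x))))

  iter-%n : ∀ x j → iter f j x ≡ iter f (j % n) x
  iter-%n x = iter-period-% f n (iter-n x)

  iter-*n : ∀ a x → iter f (a * n) x ≡ x
  iter-*n a x = iter-period-* f n (iter-n x) a

  iter-returns⇒∣ : ∀ x p → iter f p x ≡ x → n ∣ p
  iter-returns⇒∣ x p returns with p % n in p%n≡r | m%n<n p n
  ... | zero | _ = m%n≡0⇒n∣m p n p%n≡r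
  ... | suc r | r<n = ⊥-elim (<⇒≱ r<n (return-time-≥ x r
        (trans (cong (λ t → iter f t x) (sym p%n≡r)) (trans (sym (iter-%n x p)) returns))))

locate : ∀ {k} (e : Fin (suc k) → ℕ) a → e Fin.zero < a → a ≤ e (Fin.fromℕ k) →
  ∃ λ (t : Fin k) → e (inject₁ t) < a × a ≤ e (Fin.suc t)
locate {zero} e a lo hi = ⊥-elim (<⇒≱ lo hi)
locate {suc k} e a lo hi with a ≤? e (Fin.suc Fin.zero)
... | yes a≤e₁ = Fin.zero , lo , a≤e₁
... | no a≰e₁ with locate (λ t → e (Fin.suc t)) a (≰⇒> a≰e₁) hi
... | t , l , h = Fin.suc t , l , h

-- Orders on words

AgreeBelow : ∀ {A : Set} → ℕ → (ℕ → A) → (ℕ → A) → Set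
AgreeBelow N u w = ∀ l → l < N → u l ≡ w l

-- Words over Fin k are compared at their first difference j: by the letter order when E j is
-- true and by its reverse otherwise. The alternating signs give the order ≺ of the paper.
Signs : Set
Signs = ℕ → Bool

alternating : Signs
alternating zero = true
alternating (suc j) = not (alternating j)

lexicographic : Signs
lexicographic _ = true

LetterLess : ∀ {k} → Bool → Fin k → Fin k → Set
LetterLess true a b = a Fin.< b
LetterLess false a b = b Fin.< a

module _ {k : ℕ} where

  letterLess-≢ : ∀ b {a c : Fin k} → LetterLess b a c → a ≢ c
  letterLess-≢ true a<c a≡c = <-irrefl (cong toℕ a≡c) a<c
  letterLess-≢ false c<a a≡c = <-irrefl (cong toℕ (sym a≡c)) c<a

  letterLess-trans : ∀ b {a c e : Fin k} → LetterLess b a c → LetterLess b c e → LetterLess b a e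
  letterLess-trans true a<c c<e = <-trans a<c c<e
  letterLess-trans false c<a e<c = <-trans e<c c<a

  letterLess-not : ∀ b {a c : Fin k} → LetterLess (not b) a c → LetterLess b c a
  letterLess-not true c<a = c<a
  letterLess-not false a<c = a<c

  letterLess-cmp : ∀ b {a c : Fin k} → a ≢ c → LetterLess b a c ⊎ LetterLess b c a
  letterLess-cmp b {a} {c} a≢c with <-cmp (toℕ a) (toℕ c) | b
  ... | tri≈ _ eq _ | _ = ⊥-elim (a≢c (toℕ-injective eq))
  ... | tri< a<c _ _ | true = inj₁ a<c
  ... | tri< a<c _ _ | false = inj₂ a<c
  ... | tri> _ _ c<a | true = inj₂ c<a
  ... | tri> _ _ c<a | false = inj₁ c<a

  LessAt : Signs → (ℕ → Fin k) → (ℕ → Fin k) → ℕ → Set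
  LessAt E u w j = AgreeBelow j u w × LetterLess (E j) (u j) (w j)

  Less : Signs → ℕ → (ℕ → Fin k) → (ℕ → Fin k) → Set
  Less E N u w = ∃ λ j → j < N × LessAt E u w j

  module _ {E : Signs} where

    lessAt-≢ : ∀ {u w j} → LessAt E u w j → u j ≢ w j
    lessAt-≢ {j = j} (_ , lt) = letterLess-≢ (E j) lt

    lessAt-trans : ∀ {u v w i j} → LessAt E u v i → LessAt E v w j → ∃ λ l → (l ≡ i ⊎ l ≡ j) × LessAt E u w l
    lessAt-trans {u} {v} {w} {i} {j} (u≡v , u<v) (v≡w , v<w) with <-cmp i j
    ... | tri< i<j _ _ = i , inj₁ refl , (λ l l<i → trans (u≡v l l<i) (v≡w l (<-trans l<i i<j))) ,
                           subst (LetterLess (E i) (u i)) (v≡w i i<j) u<v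
    ... | tri> _ _ j<i = j , inj₂ refl , (λ l l<j → trans (u≡v l (<-trans l<j j<i)) (v≡w l l<j)) ,
                           subst (λ a → LetterLess (E j) a (w j)) (sym (u≡v j j<i)) v<w
    ... | tri≈ _ refl _ = i , inj₁ refl , (λ l l<i → trans (u≡v l l<i) (v≡w l l<i)) , letterLess-trans (E i) u<v v<w

    lessAt-cong : ∀ {u u′ w w′ j} → u ≗ u′ → w ≗ w′ → LessAt E u w j → LessAt E u′ w′ j
    lessAt-cong {j = j} u≗u′ w≗w′ (u≡w , u<w) = (λ l l<j → trans (sym (u≗u′ l)) (trans (u≡w l l<j) (w≗w′ l))) ,
      subst₂ (LetterLess (E j)) (u≗u′ j) (w≗w′ j) u<w

    lessAt-not : ∀ {u w j} → LessAt (not ∘ E) u w j → LessAt E w u j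
    lessAt-not {j = j} (u≡w , u<w) = (λ l l<j → sym (u≡w l l<j)) , letterLess-not (E j) u<w

    lessAt-tail : ∀ {u w j} → LessAt E u w (suc j) → LessAt (E ∘ suc) (u ∘ suc) (w ∘ suc) j
    lessAt-tail (u≡w , u<w) = (λ l l<j → u≡w (suc l) (s≤s l<j)) , u<w

    module _ {N : ℕ} where

      less-irrefl : ∀ {u} → ¬ Less E N u u
      less-irrefl (j , _ , lt) = lessAt-≢ lt refl

      less-trans : ∀ {u v w} → Less E N u v → Less E N v w → Less E N u w
      less-trans (i , i<N , u<v) (j , j<N , v<w) with lessAt-trans u<v v<w
      ... | l , inj₁ refl , u<w = l , i<N , u<w
      ... | l , inj₂ refl , u<w = l , j<N , u<w

      less-asym : ∀ {u w} → Less E N u w → ¬ Less E N w u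
      less-asym u<w w<u = less-irrefl (less-trans u<w w<u)

      less-cong : ∀ {u u′ w w′} → u ≗ u′ → w ≗ w′ → Less E N u w → Less E N u′ w′
      less-cong u≗u′ w≗w′ (j , j<N , u<w) = j , j<N , lessAt-cong u≗u′ w≗w′ u<w

  firstDifference : ∀ N (u w : ℕ → Fin k) → AgreeBelow N u w ⊎ (∃ λ j → j < N × AgreeBelow j u w × u j ≢ w j)
  firstDifference zero u w = inj₁ (λ l ())
  firstDifference (suc N) u w with firstDifference N u w
  ... | inj₂ (j , j<N , u≡w , uj≢wj) = inj₂ (j , m≤n⇒m≤1+n j<N , u≡w , uj≢wj)
  ... | inj₁ u≡w with u N ≟ᶠ w N
  ...   | no uN≢wN = inj₂ (N , ≤-refl , u≡w , uN≢wN)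
  ...   | yes uN≡wN = inj₁ λ l l<1+N → [ u≡w l , (λ { refl → uN≡wN }) ]′ (m≤n⇒m<n∨m≡n (s≤s⁻¹ l<1+N))

  module _ (E : Signs) {N : ℕ} where

    less-trichotomy : ∀ u w → ¬ AgreeBelow N u w → Less E N u w ⊎ Less E N w u
    less-trichotomy u w u≢w with firstDifference N u w
    ... | inj₁ u≡w = ⊥-elim (u≢w u≡w)
    ... | inj₂ (j , j<N , u≡w , uj≢wj) with letterLess-cmp (E j) uj≢wj
    ...   | inj₁ u<w = inj₁ (j , j<N , u≡w , u<w)
    ...   | inj₂ w<u = inj₂ (j , j<N , (λ l l<j → sym (u≡w l l<j)) , w<u)

    less? : ∀ u w → Dec (Less E N u w)
    less? u w with firstDifference N u w
    ... | inj₁ u≡w = no λ (j , j<N , lt) → lessAt-≢ {E = E} lt (u≡w j j<N)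
    ... | inj₂ (j , j<N , u≡w , uj≢wj) with less-trichotomy u w (λ agree → uj≢wj (agree j j<N))
    ...   | inj₁ u<w = yes u<w
    ...   | inj₂ w<u = no (less-asym w<u)

  module _ {E : Signs} (E0 : E 0 ≡ true) {N : ℕ} .{{_ : NonZero N}} where

    less-head : ∀ {u w} → u 0 Fin.< w 0 → Less E N u w
    less-head u0<w0 = 0 , >-nonZero⁻¹ N , (λ l ()) , subst (λ b → LetterLess b _ _) (sym E0) u0<w0

    less-head⁻¹ : ∀ {u w} → Less E N u w → toℕ (u 0) ≤ toℕ (w 0)
    less-head⁻¹ u<w = ≮⇒≥ λ w0<u0 → less-asym u<w (less-head w0<u0)

alternating-%2 : ∀ j → (alternating j ≡ true × j % 2 ≡ 0) ⊎ (alternating j ≡ false × j % 2 ≡ 1)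
alternating-%2 zero = inj₁ (refl , refl)
alternating-%2 (suc j) with alternating-%2 j
... | inj₁ (e , p) = inj₂ (cong not e , trans (%-distribˡ-+ 1 j 2) (cong (λ t → (1 + t) % 2) p))
... | inj₂ (e , p) = inj₁ (cong not e , trans (%-distribˡ-+ 1 j 2) (cong (λ t → (1 + t) % 2) p))

module _ {k : ℕ} where

  letterLess-alternating⇒ : ∀ j {a b : Fin k} → LetterLess (alternating j) a b → (j % 2 ≡ 0 × a Fin.< b) ⊎ (j % 2 ≡ 1 × b Fin.< a)
  letterLess-alternating⇒ j lt with alternating j | alternating-%2 j
  ... | true | inj₁ (_ , even) = inj₁ (even , lt)
  ... | false | inj₂ (_ , odd) = inj₂ (odd , lt)

  ⇒letterLess-alternating : ∀ j {a b : Fin k} → (j % 2 ≡ 0 × a Fin.< b) ⊎ (j % 2 ≡ 1 × b Fin.< a) → LetterLess (alternating j) a b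
  ⇒letterLess-alternating j cmp with alternating j | alternating-%2 j | cmp
  ... | true | _ | inj₁ (_ , a<b) = a<b
  ... | false | _ | inj₂ (_ , b<a) = b<a
  ... | true | inj₁ (_ , even) | inj₂ (odd , _) = ⊥-elim (0≢1+n (trans (sym even) odd))
  ... | false | inj₂ (_ , odd) | inj₁ (even , _) = ⊥-elim (0≢1+n (trans (sym even) odd))

  less-alternating⇒≺ : ∀ {N} {u w : ℕ → Fin k} → Less alternating N u w → u ≺ w
  less-alternating⇒≺ (j , _ , u≡w , lt) = j , u≡w , letterLess-alternating⇒ j lt

  ≺⇒less-alternating : ∀ {N} {u w : ℕ → Fin k} → (AgreeBelow N u w → u ≗ w) → u ≺ w → Less alternating N u w
  ≺⇒less-alternating {N} {u} {w} extend (j , u≡w , cmp) with j <? N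
  ... | yes j<N = j , j<N , u≡w , ⇒letterLess-alternating j cmp
  ... | no j≮N = ⊥-elim (letterLess-≢ (alternating j) (⇒letterLess-alternating j cmp)
                   (extend (λ l l<N → u≡w l (<-≤-trans l<N (≮⇒≥ j≮N))) j))

-- Blocks, itineraries and ranking

module Blocks (k : ℕ) {n : ℕ} .{{_ : NonZero n}} (d : Fin (suc k) → ℕ) (d0 : d Fin.zero ≡ 0) (dk : d (Fin.fromℕ k) ≡ n)
              (d-increasing : StrictIncr d) where

  d-mono : ∀ a b → toℕ a ≤ toℕ b → d a ≤ d b
  d-mono a b a≤b with m≤n⇒m<n∨m≡n a≤b
  ... | inj₁ a<b = <⇒≤ (d-increasing a b a<b)
  ... | inj₂ a≡b = ≤-reflexive (cong d (toℕ-injective a≡b))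

  d-reflects-< : ∀ a b → d a < d b → toℕ a < toℕ b
  d-reflects-< a b da<db = ≰⇒> (λ b≤a → <⇒≱ da<db (d-mono b a b≤a))

  -- a is a 1-based value
  InBlock : ℕ → Fin k → Set
  InBlock a t = d (inject₁ t) < a × a ≤ d (Fin.suc t)

  inBlock-unique : ∀ {a t t'} → InBlock a t → InBlock a t' → t ≡ t'
  inBlock-unique {a} {t} {t'} (l , h) (l' , h') with <-cmp (toℕ t) (toℕ t')
  ... | tri< t<t' _ _ = ⊥-elim (<⇒≱ l' (≤-trans h (d-mono (Fin.suc t) (inject₁ t') (subst (suc (toℕ t) ≤_) (sym (toℕ-inject₁ t')) t<t'))))
  ... | tri≈ _ t≡t' _ = toℕ-injective t≡t'
  ... | tri> _ _ t'<t = ⊥-elim (<⇒≱ l (≤-trans h' (d-mono (Fin.suc t') (inject₁ t) (subst (suc (toℕ t') ≤_) (sym (toℕ-inject₁ t)) t'<t))))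

  private
    located : ∀ (v : Fin n) → ∃ (InBlock (suc (toℕ v)))
    located v = locate d (suc (toℕ v)) (subst (_< suc (toℕ v)) (sym d0) (s≤s z≤n)) (subst (suc (toℕ v) ≤_) (sym dk) (toℕ<n v))

  block : Fin n → Fin k
  block v = proj₁ (located v)

  block-inBlock : ∀ v → InBlock (suc (toℕ v)) (block v)
  block-inBlock v = proj₂ (located v)

  block-unique : ∀ v t → InBlock (suc (toℕ v)) t → block v ≡ t
  block-unique v t = inBlock-unique (block-inBlock v)

  block-mono : ∀ u v → toℕ u ≤ toℕ v → toℕ (block u) ≤ toℕ (block v)
  block-mono u v u≤v = ≮⇒≥ λ bv<bu → <⇒≱ (proj₁ (block-inBlock u))
    (≤-trans (s≤s u≤v) (≤-trans (proj₂ (block-inBlock v))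
      (d-mono (Fin.suc (block v)) (inject₁ (block u)) (subst (suc (toℕ (block v)) ≤_) (sym (toℕ-inject₁ (block u))) bv<bu))))

  block-convex : ∀ u w v → toℕ u ≤ toℕ w → toℕ w ≤ toℕ v → block u ≡ block v → block w ≡ block u
  block-convex u w v u≤w w≤v bu≡bv = block-unique w (block u) (≤-trans (proj₁ (block-inBlock u)) (s≤s u≤w) ,
    ≤-trans (s≤s w≤v) (subst (λ t → suc (toℕ v) ≤ d (Fin.suc t)) (sym bu≡bv) (proj₂ (block-inBlock v))))

  sameBlock⇒∉D : ∀ p q → toℕ q ≡ suc (toℕ p) → block p ≡ block q → ¬ InD d (suc (toℕ p))
  sameBlock⇒∉D p q q≡1+p bp≡bq (t , _ , _ , dt≡1+p) = <-irrefl refl (≤-<-trans t≤b b<t)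
    where
    b = block p
    b<t : toℕ b < toℕ t
    b<t = subst (_< toℕ t) (toℕ-inject₁ b) (d-reflects-< (inject₁ b) t (subst (d (inject₁ b) <_) (sym dt≡1+p) (proj₁ (block-inBlock p))))
    t≤b : toℕ t ≤ toℕ b
    t≤b = s≤s⁻¹ (d-reflects-< t (Fin.suc b)
      (subst (λ x → suc x ≤ d (Fin.suc b)) (trans q≡1+p (sym dt≡1+p))
        (subst (λ x → suc (toℕ q) ≤ d (Fin.suc x)) (sym bp≡bq) (proj₂ (block-inBlock q)))))

  differentBlocks⇒∈D : ∀ p q → toℕ q ≡ suc (toℕ p) → block p ≢ block q → InD d (suc (toℕ p))
  differentBlocks⇒∈D p q q≡1+p bp≢bq = Fin.suc b , s≤s z≤n , 1+b<k , d[1+b]≡1+p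
    where
    b = block p
    d[1+b]≡1+p : d (Fin.suc b) ≡ suc (toℕ p)
    d[1+b]≡1+p with suc (toℕ q) ≤? d (Fin.suc b)
    ... | yes q∈b = ⊥-elim (bp≢bq (sym (block-unique q b
          (<-trans (proj₁ (block-inBlock p)) (subst (suc (toℕ p) <_) (cong suc (sym q≡1+p)) ≤-refl) , q∈b))))
    ... | no q∉b = ≤-antisym (s≤s⁻¹ (subst (d (Fin.suc b) <_) (cong suc q≡1+p) (≰⇒> q∉b))) (proj₂ (block-inBlock p))
    1+b<k : suc (toℕ b) < k
    1+b<k with m≤n⇒m<n∨m≡n (toℕ<n b)
    ... | inj₁ lt = lt
    ... | inj₂ 1+b≡k = ⊥-elim (<-irrefl (sym (trans (sym dk) (trans (sym (cong d (toℕ-injective {i = Fin.suc b}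
            (trans 1+b≡k (sym (toℕ-fromℕ k)))))) d[1+b]≡1+p))) (subst (_< n) q≡1+p (toℕ<n q)))

  sameBlock-induction : (R : Fin n → Fin n → Set) → (∀ a b e → R a b → R b e → R a e) →
    (∀ p q → toℕ q ≡ suc (toℕ p) → block p ≡ block q → R p q) →
    ∀ u v → block u ≡ block v → toℕ u < toℕ v → R u v
  sameBlock-induction R R-trans R-adjacent u v bu≡bv u<v = go (toℕ v ∸ suc (toℕ u)) u v (sym (m+[n∸m]≡n u<v)) bu≡bv
    where
    go : ∀ g u v → toℕ v ≡ suc (toℕ u) + g → block u ≡ block v → R u v
    go zero u v v≡1+u bu≡bv = R-adjacent u v (trans v≡1+u (+-identityʳ _)) bu≡bv
    go (suc g) u v v≡u+2+g bu≡bv = R-trans u w v (R-adjacent u w (toℕ-fromℕ< w<n) (sym bw≡bu)) (go g w v v≡w+1+g (trans bw≡bu bu≡bv))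
      where
      1+u<v : suc (toℕ u) < toℕ v
      1+u<v = ≤-trans (m≤m+n (suc (suc (toℕ u))) g) (≤-reflexive (sym (trans v≡u+2+g (+-suc (suc (toℕ u)) g))))
      w<n : suc (toℕ u) < n
      w<n = <-trans 1+u<v (toℕ<n v)
      w = fromℕ< w<n
      bw≡bu : block w ≡ block u
      bw≡bu = block-convex u w v (subst (toℕ u ≤_) (sym (toℕ-fromℕ< w<n)) (n≤1+n _))
                                 (subst (_≤ toℕ v) (sym (toℕ-fromℕ< w<n)) (<⇒≤ 1+u<v)) bu≡bv
      v≡w+1+g : toℕ v ≡ suc (toℕ w) + g
      v≡w+1+g = trans v≡u+2+g (trans (+-suc (suc (toℕ u)) g) (cong (λ x → suc x + g) (sym (toℕ-fromℕ< w<n))))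

  IncreasingOnBlocks : (Fin n → Fin n) → Set
  IncreasingOnBlocks f = ∀ u v → block u ≡ block v → u Fin.< v → f u Fin.< f v

  DecreasingOnBlocks : (Fin n → Fin n) → Set
  DecreasingOnBlocks f = ∀ u v → block u ≡ block v → u Fin.< v → f v Fin.< f u

  private
    adjacent-≢ : (f : Fin n → Fin n) → Injectiveᶠ f → ∀ p q → toℕ q ≡ suc (toℕ p) → f p ≢ f q
    adjacent-≢ f inj p q q≡1+p fp≡fq = <-irrefl (cong toℕ (inj p q fp≡fq)) (≤-reflexive (sym q≡1+p))

  desIn⇒increasingOnBlocks : ∀ τ → IsPerm τ → DesIn d τ → IncreasingOnBlocks (lookup τ)
  desIn⇒increasingOnBlocks τ perm des = sameBlock-induction (λ u v → lookup τ u Fin.< lookup τ v) (λ _ _ _ → <-trans) adjacent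
    where
    adjacent : ∀ p q → toℕ q ≡ suc (toℕ p) → block p ≡ block q → lookup τ p Fin.< lookup τ q
    adjacent p q q≡1+p bp≡bq = ≤∧≢⇒< (≮⇒≥ λ τq<τp → sameBlock⇒∉D p q q≡1+p bp≡bq (des p q q≡1+p τq<τp))
      (λ eq → adjacent-≢ (lookup τ) perm p q q≡1+p (toℕ-injective eq))

  ascIn⇒decreasingOnBlocks : ∀ τ → IsPerm τ → AscIn d τ → DecreasingOnBlocks (lookup τ)
  ascIn⇒decreasingOnBlocks τ perm asc = sameBlock-induction (λ u v → lookup τ v Fin.< lookup τ u) (λ _ _ _ a b → <-trans b a) adjacent
    where
    adjacent : ∀ p q → toℕ q ≡ suc (toℕ p) → block p ≡ block q → lookup τ q Fin.< lookup τ p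
    adjacent p q q≡1+p bp≡bq = ≤∧≢⇒< (≮⇒≥ λ τp<τq → sameBlock⇒∉D p q q≡1+p bp≡bq (asc p q q≡1+p τp<τq))
      (λ eq → adjacent-≢ (lookup τ) perm p q q≡1+p (sym (toℕ-injective eq)))

  increasingOnBlocks⇒desIn : ∀ τ → IncreasingOnBlocks (lookup τ) → DesIn d τ
  increasingOnBlocks⇒desIn τ incr p q q≡1+p τq<τp with block p ≟ᶠ block q
  ... | yes bp≡bq = ⊥-elim (<-asym τq<τp (incr p q bp≡bq (≤-reflexive (sym q≡1+p))))
  ... | no bp≢bq = differentBlocks⇒∈D p q q≡1+p bp≢bq

  decreasingOnBlocks⇒ascIn : ∀ τ → DecreasingOnBlocks (lookup τ) → AscIn d τ
  decreasingOnBlocks⇒ascIn τ decr p q q≡1+p τp<τq with block p ≟ᶠ block q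
  ... | yes bp≡bq = ⊥-elim (<-asym τp<τq (decr p q bp≡bq (≤-reflexive (sym q≡1+p))))
  ... | no bp≢bq = differentBlocks⇒∈D p q q≡1+p bp≢bq

  itinerary : (Fin n → Fin n) → Fin n → ℕ → Fin k
  itinerary f x j = block (iter f j x)

  itinerary-suc : ∀ f x j → itinerary f (f x) j ≡ itinerary f x (suc j)
  itinerary-suc f x j = cong block (iter-commute f j x)

  lessAt-itinerary-tail : ∀ {E f x y j} → LessAt E (itinerary f x) (itinerary f y) (suc j) →
    LessAt (E ∘ suc) (itinerary f (f x)) (itinerary f (f y)) j
  lessAt-itinerary-tail {E} {f} {x} {y} lt =
    lessAt-cong {E = E ∘ suc} (λ l → sym (itinerary-suc f x l)) (λ l → sym (itinerary-suc f y l)) (lessAt-tail {E = E} lt)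

  itinerary-cong : ∀ {f g} → f ≗ g → ∀ x j → itinerary f x j ≡ itinerary g x j
  itinerary-cong f≗g x j = cong block (iter-cong f≗g j x)

  SameItinerary : (Fin n → Fin n) → Fin n → Fin n → Set
  SameItinerary f x y = ∀ j → itinerary f x j ≡ itinerary f y j

  sameItinerary-iter : ∀ {f x y} → SameItinerary f x y → ∀ a → SameItinerary f (iter f a x) (iter f a y)
  sameItinerary-iter {f} {x} {y} same a j = begin
    block (iter f j (iter f a x)) ≡⟨ cong block (iter-+ f j a x) ⟨
    block (iter f (j + a) x)      ≡⟨ same (j + a) ⟩
    block (iter f (j + a) y)      ≡⟨ cong block (iter-+ f j a y) ⟩
    block (iter f j (iter f a y)) ∎
    where open ≡-Reasoning

  Primitive : (Fin n → Fin n) → Set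
  Primitive f = ∀ x y → AgreeBelow n (itinerary f x) (itinerary f y) → x ≡ y

  primitive-cong : ∀ {f g} → f ≗ g → Primitive g → Primitive f
  primitive-cong f≗g prim x y agree = prim x y (λ l l<n →
    trans (sym (itinerary-cong f≗g x l)) (trans (agree l l<n) (itinerary-cong f≗g y l)))

  iter-increasingOnSameItinerary : ∀ {f} → IncreasingOnBlocks f →
    ∀ q u v → SameItinerary f u v → u Fin.< v → iter f q u Fin.< iter f q v
  iter-increasingOnSameItinerary incr zero u v same u<v = u<v
  iter-increasingOnSameItinerary incr (suc q) u v same u<v = incr _ _ (same q) (iter-increasingOnSameItinerary incr q u v same u<v)

  iter-2*-increasingOnSameItinerary : ∀ {f} → DecreasingOnBlocks f →
    ∀ r u v → SameItinerary f u v → u Fin.< v → iter f (r * 2) u Fin.< iter f (r * 2) v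
  iter-2*-increasingOnSameItinerary decr zero u v same u<v = u<v
  iter-2*-increasingOnSameItinerary {f} decr (suc r) u v same u<v =
    decr _ _ (sym (same′ 1)) (decr _ _ (same′ 0) (iter-2*-increasingOnSameItinerary decr r u v same u<v))
    where same′ = sameItinerary-iter same (r * 2)

  module _ (f : Fin n → Fin n) (cyclic : Cyclic f) where
    open CyclicMap f cyclic

    agreeBelow-n⇒sameItinerary : ∀ x y → AgreeBelow n (itinerary f x) (itinerary f y) → SameItinerary f x y
    agreeBelow-n⇒sameItinerary x y agree j =
      trans (cong block (iter-%n x j)) (trans (agree (j % n) (m%n<n j n)) (sym (cong block (iter-%n y j))))

    -- the orbit of x under f^e would be ≺-increasing, yet it returns to x after n steps
    private
      monotoneOrbit-noReturn : ∀ e x → SameItinerary f x (iter f e x) →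
        (_≺_ : Rel (Fin n) 0ℓ) → Transitive _≺_ → Irreflexive _≡_ _≺_ →
        (∀ u v → SameItinerary f u v → u ≺ v → iter f e u ≺ iter f e v) → ¬ (x ≺ iter f e x)
      monotoneOrbit-noReturn e x same-x-fᵉx _≺_ ≺-trans ≺-irrefl mono x≺fᵉx =
        strictChain-noReturn _≺_ ≺-trans ≺-irrefl orbit step (>-nonZero⁻¹ n) orbit-n
        where
        orbit : ℕ → Fin n
        orbit a = iter (iter f e) a x
        orbit-same : ∀ a → SameItinerary f (orbit a) (orbit (suc a))
        orbit-same zero = same-x-fᵉx
        orbit-same (suc a) = sameItinerary-iter (orbit-same a) e
        orbit-n : orbit n ≡ x
        orbit-n = trans (iter-iter f e n x) (trans (cong (λ t → iter f t x) (*-comm n e)) (iter-*n e x))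
        step : ∀ a → orbit a ≺ orbit (suc a)
        step zero = x≺fᵉx
        step (suc a) = mono _ _ (orbit-same a) (step a)

    sameItinerary-returns : ∀ e → (∀ u v → SameItinerary f u v → u Fin.< v → iter f e u Fin.< iter f e v) →
      ∀ x → SameItinerary f x (iter f e x) → iter f e x ≡ x
    sameItinerary-returns e mono x same with <-cmp (toℕ x) (toℕ (iter f e x))
    ... | tri≈ _ eq _ = sym (toℕ-injective eq)
    ... | tri< x<fᵉx _ _ = ⊥-elim (monotoneOrbit-noReturn e x same Fin._<_ <-trans (λ eq → <-irrefl (cong toℕ eq)) mono x<fᵉx)
    ... | tri> _ _ fᵉx<x = ⊥-elim (monotoneOrbit-noReturn e x same (λ u v → v Fin.< u) (λ u<v v<w → <-trans v<w u<v)
          (λ eq → <-irrefl (cong toℕ (sym eq))) (λ u v same-uv → mono v u (λ j → sym (same-uv j))) fᵉx<x)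

    private
      steps : Fin n → Fin n → ℕ
      steps x y = proj₁ (proj₂ cyclic x y)
      iter-steps : ∀ x y → iter f (steps x y) x ≡ y
      iter-steps x y = proj₂ (proj₂ cyclic x y)

    increasingOnBlocks⇒primitive : IncreasingOnBlocks f → Primitive f
    increasingOnBlocks⇒primitive incr x y agree = trans (sym fixed) (iter-steps x y)
      where
      q = steps x y
      fixed : iter f q x ≡ x
      fixed = sameItinerary-returns q (iter-increasingOnSameItinerary incr q) x
        (subst (SameItinerary f x) (sym (iter-steps x y)) (agreeBelow-n⇒sameItinerary x y agree))

    -- Only even powers of f preserve the order of points with equal itineraries. An odd return
    -- time q is replaced by the even q + n when n is odd; when 4 ∣ n, f^(2q) would fix x although
    -- n ∤ 2q. This is where n % 4 ≢ 2 enters.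
    decreasingOnBlocks⇒primitive : DecreasingOnBlocks f → n % 4 ≢ 2 → Primitive f
    decreasingOnBlocks⇒primitive decr n%4≢2 x y agree = trans (sym fixed) (iter-steps x y)
      where
      q = steps x y
      same-x-y : SameItinerary f x y
      same-x-y = agreeBelow-n⇒sameItinerary x y agree
      same-x-fᵠx : SameItinerary f x (iter f q x)
      same-x-fᵠx = subst (SameItinerary f x) (sym (iter-steps x y)) same-x-y
      evenReturns : ∀ e → 2 ∣ e → SameItinerary f x (iter f e x) → iter f e x ≡ x
      evenReturns .(r * 2) (divides-refl r) = sameItinerary-returns (r * 2) (iter-2*-increasingOnSameItinerary decr r) x
      fᵠ⁺ⁿx≡fᵠx : iter f (q + n) x ≡ iter f q x
      fᵠ⁺ⁿx≡fᵠx = trans (iter-+ f q n x) (cong (iter f q) (iter-n x))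
      f²ᵠx≡fᵠy : iter f (q * 2) x ≡ iter f q y
      f²ᵠx≡fᵠy = begin
        iter f (q * 2) x       ≡⟨ cong (λ t → iter f t x) (trans (*-comm q 2) (cong (q +_) (+-identityʳ q))) ⟩
        iter f (q + q) x       ≡⟨ iter-+ f q q x ⟩
        iter f q (iter f q x)  ≡⟨ cong (iter f q) (iter-steps x y) ⟩
        iter f q y             ∎
        where open ≡-Reasoning
      same-x-f²ᵠx : SameItinerary f x (iter f (q * 2) x)
      same-x-f²ᵠx j = trans (same-x-fᵠx j) (trans (sameItinerary-iter same-x-y q j) (cong (λ z → itinerary f z j) (sym f²ᵠx≡fᵠy)))
      fixed : iter f q x ≡ x
      fixed with %2-cases q
      ... | inj₁ q-even = evenReturns q (m%n≡0⇒n∣m q 2 q-even) same-x-fᵠx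
      ... | inj₂ q-odd with %4≢2⇒odd⊎4∣ n n%4≢2
      ...   | inj₁ n-odd = trans (sym fᵠ⁺ⁿx≡fᵠx)
              (evenReturns (q + n) (odd+odd-even q n q-odd n-odd) (subst (SameItinerary f x) (sym fᵠ⁺ⁿx≡fᵠx) same-x-fᵠx))
      ...   | inj₂ 4∣n = ⊥-elim (4∣2*odd⇒⊥ q q-odd
              (∣-trans 4∣n (iter-returns⇒∣ x (q * 2) (evenReturns (q * 2) (divides q refl) same-x-f²ᵠx))))

  module Ranking (E : Signs) (E0 : E 0 ≡ true) (f : Fin n → Fin n) where

    _⊏_ : Fin n → Fin n → Set
    x ⊏ y = Less E n (itinerary f x) (itinerary f y)

    _⊏?_ : ∀ x y → Dec (x ⊏ y)
    x ⊏? y = less? E (itinerary f x) (itinerary f y)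

    rank : Fin n → ℕ
    rank x = count (_⊏ x) (_⊏? x)

    rank<n : ∀ x → rank x < n
    rank<n x = subst (rank x <_) (count-all (λ _ → ⊤) (λ _ → yes tt) (λ _ → tt))
      (count-strict (_⊏ x) (λ _ → ⊤) (_⊏? x) (λ _ → yes tt) (λ _ _ → tt) x tt less-irrefl)

    abstract
      ρ : Fin n → Fin n
      ρ x = fromℕ< (rank<n x)

      toℕ-ρ : ∀ x → toℕ (ρ x) ≡ rank x
      toℕ-ρ x = toℕ-fromℕ< (rank<n x)

    ρ-mono : ∀ {x y} → x ⊏ y → ρ x Fin.< ρ y
    ρ-mono {x} {y} x⊏y = subst₂ _<_ (sym (toℕ-ρ x)) (sym (toℕ-ρ y))
      (count-strict (_⊏ x) (_⊏ y) (_⊏? x) (_⊏? y) (λ z z⊏x → less-trans z⊏x x⊏y) x x⊏y less-irrefl)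

    -- Points in earlier blocks all precede x (first letters decide) and points in later blocks
    -- all follow it, so rank x lies between the d-values bounding the block of x.
    block-ρ : ∀ x → block (ρ x) ≡ block x
    block-ρ x = block-unique (ρ x) t (lower , upper)
      where
      t = block x
      A = d (inject₁ t)
      B = d (Fin.suc t)
      A≤n : A ≤ n
      A≤n = ≤-trans (<⇒≤ (proj₁ (block-inBlock x))) (toℕ<n x)
      B≤n : B ≤ n
      B≤n = subst (B ≤_) dk (d-mono (Fin.suc t) (Fin.fromℕ k) (subst (suc (toℕ t) ≤_) (sym (toℕ-fromℕ k)) (toℕ<n t)))
      earlier⇒⊏ : ∀ y → toℕ y < A → y ⊏ x
      earlier⇒⊏ y y<A = less-head E0 (≰⇒> λ t≤by →
        <⇒≱ y<A (s≤s⁻¹ (≤-trans (s≤s (d-mono (inject₁ t) (inject₁ (block y))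
          (subst₂ _≤_ (sym (toℕ-inject₁ t)) (sym (toℕ-inject₁ (block y))) t≤by))) (proj₁ (block-inBlock y)))))
      ⊏⇒notLater : ∀ y → y ⊏ x → toℕ y < B
      ⊏⇒notLater y y⊏x = ≤-trans (proj₂ (block-inBlock y)) (d-mono (Fin.suc (block y)) (Fin.suc t) (s≤s (less-head⁻¹ E0 y⊏x)))
      lower : A < suc (toℕ (ρ x))
      lower = s≤s (subst₂ _≤_ (count-toℕ< A A≤n) (sym (toℕ-ρ x))
        (count-mono (λ y → toℕ y < A) (_⊏ x) (λ y → toℕ y <? A) (_⊏? x) earlier⇒⊏))
      upper : suc (toℕ (ρ x)) ≤ B
      upper = subst₂ _<_ (sym (toℕ-ρ x)) (count-toℕ< B B≤n)
        (count-strict (_⊏ x) (λ y → toℕ y < B) (_⊏? x) (λ y → toℕ y <? B) ⊏⇒notLater x (proj₂ (block-inBlock x)) less-irrefl)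

    conjugate : Fin n → Fin n
    conjugate v = ρ (f (invert ρ v))

    module _ (cyclic : Cyclic f) (prim : Primitive f) where

      ρ-injective : Injectiveᶠ ρ
      ρ-injective x y ρx≡ρy with firstDifference n (itinerary f x) (itinerary f y)
      ... | inj₁ agree = prim x y agree
      ... | inj₂ (j , j<n , _ , differ) with less-trichotomy E (itinerary f x) (itinerary f y) (λ agree → differ (agree j j<n))
      ...   | inj₁ x⊏y = ⊥-elim (<-irrefl (cong toℕ ρx≡ρy) (ρ-mono x⊏y))
      ...   | inj₂ y⊏x = ⊥-elim (<-irrefl (cong toℕ (sym ρx≡ρy)) (ρ-mono y⊏x))

      ρ-reflects : ∀ {x y} → ρ x Fin.< ρ y → x ⊏ y
      ρ-reflects {x} {y} ρx<ρy with less-trichotomy E (itinerary f x) (itinerary f y)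
                                      (λ agree → <-irrefl (cong (toℕ ∘ ρ) (prim x y agree)) ρx<ρy)
      ... | inj₁ x⊏y = x⊏y
      ... | inj₂ y⊏x = ⊥-elim (<-asym ρx<ρy (ρ-mono y⊏x))

      ρ-section : ∀ v → ρ (invert ρ v) ≡ v
      ρ-section = invert-section ρ ρ-injective

      ρ-retraction : ∀ x → invert ρ (ρ x) ≡ x
      ρ-retraction = invert-retraction ρ ρ-injective

      conjugate-ρ : ∀ x → conjugate (ρ x) ≡ ρ (f x)
      conjugate-ρ x = cong (ρ ∘ f) (ρ-retraction x)

      iter-conjugate-ρ : ∀ a x → iter conjugate a (ρ x) ≡ ρ (iter f a x)
      iter-conjugate-ρ a x = sym (iter-natural f conjugate ρ (λ y → sym (conjugate-ρ y)) a x)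

      itinerary-conjugate-ρ : ∀ x j → itinerary conjugate (ρ x) j ≡ itinerary f x j
      itinerary-conjugate-ρ x j = trans (cong block (iter-conjugate-ρ j x)) (block-ρ (iter f j x))

      conjugate-cyclic : Cyclic conjugate
      conjugate-cyclic = injective , reach
        where
        injective : Injectiveᶠ conjugate
        injective v w eq = trans (sym (ρ-section v)) (trans (cong ρ (proj₁ cyclic _ _ (ρ-injective _ _ eq))) (ρ-section w))
        reach : ∀ v w → ∃ λ a → iter conjugate a v ≡ w
        reach v w with proj₂ cyclic (invert ρ v) (invert ρ w)
        ... | a , reached = a , (begin
          iter conjugate a v                 ≡⟨ cong (iter conjugate a) (ρ-section v) ⟨
          iter conjugate a (ρ (invert ρ v))  ≡⟨ iter-conjugate-ρ a (invert ρ v) ⟩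
          ρ (iter f a (invert ρ v))          ≡⟨ cong ρ reached ⟩
          ρ (invert ρ w)                     ≡⟨ ρ-section w ⟩
          w                                  ∎)
          where open ≡-Reasoning

      conjugate-primitive : Primitive conjugate
      conjugate-primitive v w agree = trans (sym (ρ-section v)) (trans (cong ρ (prim _ _ agree′)) (ρ-section w))
        where
        itinerary-conjugate : ∀ u j → itinerary conjugate u j ≡ itinerary f (invert ρ u) j
        itinerary-conjugate u j = trans (cong (λ z → itinerary conjugate z j) (sym (ρ-section u))) (itinerary-conjugate-ρ (invert ρ u) j)
        agree′ : AgreeBelow n (itinerary f (invert ρ v)) (itinerary f (invert ρ w))
        agree′ l l<n = trans (sym (itinerary-conjugate v l)) (trans (agree l l<n) (itinerary-conjugate w l))

      -- p, q in the same block have preimages with the same first letter, so ρ compares their tails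
      sameBlock-tailLess : ∀ p q → block p ≡ block q → p Fin.< q →
        Less (E ∘ suc) n (itinerary f (f (invert ρ p))) (itinerary f (f (invert ρ q)))
      sameBlock-tailLess p q bp≡bq p<q with ρ-reflects {invert ρ p} {invert ρ q} (subst₂ Fin._<_ (sym (ρ-section p)) (sym (ρ-section q)) p<q)
      ... | zero , _ , lt = ⊥-elim (lessAt-≢ {E = E} lt (begin
          block (invert ρ p)      ≡⟨ block-ρ (invert ρ p) ⟨
          block (ρ (invert ρ p))  ≡⟨ cong block (ρ-section p) ⟩
          block p                 ≡⟨ bp≡bq ⟩
          block q                 ≡⟨ cong block (ρ-section q) ⟨
          block (ρ (invert ρ q))  ≡⟨ block-ρ (invert ρ q) ⟩
          block (invert ρ q)      ∎))
        where open ≡-Reasoning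
      ... | suc j , 1+j<n , lt = j , <-trans (n<1+n j) 1+j<n , lessAt-itinerary-tail {E = E} lt

  module _ (f : Fin n → Fin n) (cyclic : Cyclic f) (prim : Primitive f) where

    private
      module Lex = Ranking lexicographic refl f
      module Alt = Ranking alternating refl f

    conjugate-lexicographic-increasing : IncreasingOnBlocks Lex.conjugate
    conjugate-lexicographic-increasing p q bp≡bq p<q = Lex.ρ-mono (Lex.sameBlock-tailLess cyclic prim p q bp≡bq p<q)

    conjugate-alternating-decreasing : DecreasingOnBlocks Alt.conjugate
    conjugate-alternating-decreasing p q bp≡bq p<q with Alt.sameBlock-tailLess cyclic prim p q bp≡bq p<q
    ... | j , j<n , lt = Alt.ρ-mono (j , j<n , lessAt-not {E = alternating} lt)

  module _ {f : Fin n → Fin n} (prim : Primitive f) where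

    increasing⇒lexicographic-mono : IncreasingOnBlocks f → ∀ x y → x Fin.< y →
      Less lexicographic n (itinerary f x) (itinerary f y)
    increasing⇒lexicographic-mono incr x y x<y
      with less-trichotomy lexicographic (itinerary f x) (itinerary f y) (λ agree → <-irrefl (cong toℕ (prim x y agree)) x<y)
    ... | inj₁ x⊏y = x⊏y
    ... | inj₂ (j , _ , y⊏x) = ⊥-elim (noInversion j x y x<y y⊏x)
      where
      noInversion : ∀ j x y → x Fin.< y → ¬ LessAt lexicographic (itinerary f y) (itinerary f x) j
      noInversion zero x y x<y (_ , by<bx) = <⇒≱ by<bx (block-mono x y (<⇒≤ x<y))
      noInversion (suc j) x y x<y y⊏x = noInversion j (f x) (f y) (incr x y (sym (proj₁ y⊏x 0 (s≤s z≤n))) x<y)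
        (lessAt-itinerary-tail {E = lexicographic} y⊏x)

    decreasing⇒alternating-mono : DecreasingOnBlocks f → ∀ x y → x Fin.< y →
      Less alternating n (itinerary f x) (itinerary f y)
    decreasing⇒alternating-mono decr x y x<y
      with less-trichotomy alternating (itinerary f x) (itinerary f y) (λ agree → <-irrefl (cong toℕ (prim x y agree)) x<y)
    ... | inj₁ x⊏y = x⊏y
    ... | inj₂ (j , _ , y⊏x) = ⊥-elim (noInversion j x y x<y y⊏x)
      where
      noInversion : ∀ j x y → x Fin.< y → ¬ LessAt alternating (itinerary f y) (itinerary f x) j
      noInversion zero x y x<y (_ , by<bx) = <⇒≱ by<bx (block-mono x y (<⇒≤ x<y))
      noInversion (suc j) x y x<y y⊏x = noInversion j (f y) (f x) (decr x y (sym (proj₁ y⊏x 0 (s≤s z≤n))) x<y)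
        (lessAt-not {E = alternating} (lessAt-itinerary-tail {E = alternating} y⊏x))

  -- the composite ranking R₂.ρ ∘ R₁.ρ is strictly increasing, hence the identity
  conjugate-inverse : ∀ (E₁ E₂ : Signs) (E₁0 : E₁ 0 ≡ true) (E₂0 : E₂ 0 ≡ true) (f g : Fin n → Fin n) →
    (cyclic : Cyclic f) (prim : Primitive f) → g ≗ Ranking.conjugate E₁ E₁0 f →
    (∀ x y → x Fin.< y → Less E₂ n (itinerary f x) (itinerary f y)) →
    Ranking.conjugate E₂ E₂0 g ≗ f
  conjugate-inverse E₁ E₂ E₁0 E₂0 f g cyclic prim g≗ E₂-mono v = begin
      R₂.ρ (g (invert R₂.ρ v))  ≡⟨ cong (R₂.ρ ∘ g) ρ₂⁻¹≡ρ₁ ⟩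
      R₂.ρ (g (R₁.ρ v))         ≡⟨ cong R₂.ρ (trans (g≗ _) (R₁.conjugate-ρ cyclic prim v)) ⟩
      R₂.ρ (R₁.ρ (f v))         ≡⟨ ρ₂∘ρ₁≗id (f v) ⟩
      f v                       ∎
    where
    open ≡-Reasoning
    module R₁ = Ranking E₁ E₁0 f
    module R₂ = Ranking E₂ E₂0 g
    g-cyclic : Cyclic g
    g-cyclic = cyclic-cong g≗ (R₁.conjugate-cyclic cyclic prim)
    g-primitive : Primitive g
    g-primitive = primitive-cong g≗ (R₁.conjugate-primitive cyclic prim)
    itinerary-g-ρ₁ : ∀ x j → itinerary g (R₁.ρ x) j ≡ itinerary f x j
    itinerary-g-ρ₁ x j = trans (itinerary-cong g≗ (R₁.ρ x) j) (R₁.itinerary-conjugate-ρ cyclic prim x j)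
    ρ₂∘ρ₁≗id : ∀ x → R₂.ρ (R₁.ρ x) ≡ x
    ρ₂∘ρ₁≗id = strictlyIncreasing⇒≗id (R₂.ρ ∘ R₁.ρ) λ x y x<y →
      R₂.ρ-mono (less-cong (λ l → sym (itinerary-g-ρ₁ x l)) (λ l → sym (itinerary-g-ρ₁ y l)) (E₂-mono x y x<y))
    ρ₂⁻¹≡ρ₁ : invert R₂.ρ v ≡ R₁.ρ v
    ρ₂⁻¹≡ρ₁ = trans (cong (invert R₂.ρ) (sym (ρ₂∘ρ₁≗id v))) (R₂.ρ-retraction g-cyclic g-primitive (R₁.ρ v))

-- The bijection

module Correspondence (k m : ℕ) (d : Fin (suc k) → ℕ) (d0 : d Fin.zero ≡ 0) (dk : d (Fin.fromℕ k) ≡ suc m)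
                      (d-increasing : StrictIncr d) where

  open Blocks k d d0 dk d-increasing

  n : ℕ
  n = suc m

  position : Fin n → ℕ → Fin n
  position i j = fromℕ< (m%n<n (toℕ i + j) n)

  position-zero : ∀ i → position i 0 ≡ i
  position-zero i = toℕ-injective (trans (toℕ-fromℕ< (m%n<n (toℕ i + 0) n))
    (trans (cong (_% n) (+-identityʳ (toℕ i))) (m<n⇒m%n≡m (toℕ<n i))))

  position-suc : ∀ i j → position i (suc j) ≡ csuc (position i j)
  position-suc i j = toℕ-injective (begin
    toℕ (position i (suc j))  ≡⟨ toℕ-fromℕ< (m%n<n (toℕ i + suc j) n) ⟩
    (toℕ i + suc j) % n       ≡⟨ cong (_% n) (+-suc (toℕ i) j) ⟩
    suc (toℕ i + j) % n       ≡⟨ [1+m%n]%n≡[1+m]%n (toℕ i + j) n ⟨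
    suc ((toℕ i + j) % n) % n ≡⟨ cong (λ t → suc t % n) (toℕ-fromℕ< (m%n<n (toℕ i + j) n)) ⟨
    suc (toℕ (position i j)) % n ≡⟨ toℕ-fromℕ< (m%n<n (suc (toℕ (position i j))) n) ⟨
    toℕ (csuc (position i j)) ∎)
    where open ≡-Reasoning

  hat-iter : ∀ π τ → IsHat π τ → ∀ i j → lookup π (position i j) ≡ iter (lookup τ) j (lookup π i)
  hat-iter π τ hat i zero = cong (lookup π) (position-zero i)
  hat-iter π τ hat i (suc j) =
    trans (cong (lookup π) (position-suc i j)) (trans (sym (hat (position i j))) (cong (lookup τ) (hat-iter π τ hat i j)))

  suffix≡itinerary : ∀ π τ s → IsHat π τ → Coding d π s → ∀ i j → suffix s i j ≡ itinerary (lookup τ) (lookup π i) j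
  suffix≡itinerary π τ s hat coding i j =
    trans (sym (block-unique (lookup π (position i j)) (s (position i j)) (coding (position i j)))) (cong block (hat-iter π τ hat i j))

  δ : Vec (Fin n) n → Vec (Fin n) n
  δ τ = tabulate (Ranking.conjugate alternating refl (lookup τ))

  ε : Vec (Fin n) n → Vec (Fin n) n
  ε σ = tabulate (Ranking.conjugate lexicographic refl (lookup σ))

  module _ (τ : Vec (Fin n) n) (cyclic : IsCyclic τ) (des : DesIn d τ) where

    private
      incr = desIn⇒increasingOnBlocks τ (proj₁ cyclic) des
      prim = increasingOnBlocks⇒primitive (lookup τ) cyclic incr
      open Ranking alternating refl (lookup τ)
      lookup-δ : lookup (δ τ) ≗ conjugate
      lookup-δ = lookup∘tabulate conjugate

    δ-pattern : ∀ π → IsPerm π → IsHat π τ → ∀ s → Coding d π s → ∃ λ π′ → IsΠ s π′ × IsHat π′ (δ τ)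
    δ-pattern π perm hat s coding = π′ , (π′-perm , π′-order) , π′-hat
      where
      π′ = tabulate (ρ ∘ lookup π)
      lookup-π′ : lookup π′ ≗ ρ ∘ lookup π
      lookup-π′ = lookup∘tabulate (ρ ∘ lookup π)
      π′-perm : IsPerm π′
      π′-perm i j eq = perm i j (ρ-injective cyclic prim _ _ (trans (sym (lookup-π′ i)) (trans eq (lookup-π′ j))))
      suffix≗ = suffix≡itinerary π τ s hat coding
      periodic : ∀ i j → AgreeBelow n (suffix s i) (suffix s j) → suffix s i ≗ suffix s j
      periodic i j agree l = begin
        suffix s i l                        ≡⟨ suffix≗ i l ⟩
        itinerary (lookup τ) (lookup π i) l ≡⟨ agreeBelow-n⇒sameItinerary (lookup τ) cyclic _ _ agree′ l ⟩
        itinerary (lookup τ) (lookup π j) l ≡⟨ suffix≗ j l ⟨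
        suffix s j l                        ∎
        where
        open ≡-Reasoning
        agree′ : AgreeBelow n (itinerary (lookup τ) (lookup π i)) (itinerary (lookup τ) (lookup π j))
        agree′ l′ l′<n = trans (sym (suffix≗ i l′)) (trans (agree l′ l′<n) (suffix≗ j l′))
      π′-order : ∀ i j → (lookup π′ i Fin.< lookup π′ j → suffix s i ≺ suffix s j) ×
                         (suffix s i ≺ suffix s j → lookup π′ i Fin.< lookup π′ j)
      π′-order i j =
        (λ π′i<π′j → less-alternating⇒≺ (less-cong (λ l → sym (suffix≗ i l)) (λ l → sym (suffix≗ j l))
          (ρ-reflects cyclic prim (subst₂ Fin._<_ (lookup-π′ i) (lookup-π′ j) π′i<π′j)))) ,
        (λ sᵢ≺sⱼ → subst₂ Fin._<_ (sym (lookup-π′ i)) (sym (lookup-π′ j))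
          (ρ-mono (less-cong (suffix≗ i) (suffix≗ j) (≺⇒less-alternating (periodic i j) sᵢ≺sⱼ))))
      π′-hat : IsHat π′ (δ τ)
      π′-hat i = begin
        lookup (δ τ) (lookup π′ i)     ≡⟨ cong (lookup (δ τ)) (lookup-π′ i) ⟩
        lookup (δ τ) (ρ (lookup π i))  ≡⟨ lookup-δ _ ⟩
        conjugate (ρ (lookup π i))     ≡⟨ conjugate-ρ cyclic prim _ ⟩
        ρ (lookup τ (lookup π i))      ≡⟨ cong ρ (hat i) ⟩
        ρ (lookup π (csuc i))          ≡⟨ lookup-π′ (csuc i) ⟨
        lookup π′ (csuc i)             ∎
        where open ≡-Reasoning

    δ-cyclic-ascIn : IsCyclic (δ τ) × AscIn d (δ τ)
    δ-cyclic-ascIn = cyclic-cong lookup-δ (conjugate-cyclic cyclic prim) ,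
      decreasingOnBlocks⇒ascIn (δ τ) λ u v bu≡bv u<v → subst₂ Fin._<_ (sym (lookup-δ v)) (sym (lookup-δ u))
        (conjugate-alternating-decreasing (lookup τ) cyclic prim u v bu≡bv u<v)

    ε-δ : ε (δ τ) ≡ τ
    ε-δ = trans (tabulate-cong (conjugate-inverse alternating lexicographic refl refl (lookup τ) (lookup (δ τ))
      cyclic prim lookup-δ (increasing⇒lexicographic-mono prim incr))) (tabulate∘lookup τ)

  module _ (σ : Vec (Fin n) n) (cyclic : IsCyclic σ) (asc : AscIn d σ) (n%4≢2 : n % 4 ≢ 2) where

    private
      decr = ascIn⇒decreasingOnBlocks σ (proj₁ cyclic) asc
      prim = decreasingOnBlocks⇒primitive (lookup σ) cyclic decr n%4≢2
      open Ranking lexicographic refl (lookup σ)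
      lookup-ε : lookup (ε σ) ≗ conjugate
      lookup-ε = lookup∘tabulate conjugate

    ε-cyclic : IsCyclic (ε σ)
    ε-cyclic = cyclic-cong lookup-ε (conjugate-cyclic cyclic prim)

    ε-desIn : DesIn d (ε σ)
    ε-desIn = increasingOnBlocks⇒desIn (ε σ) λ u v bu≡bv u<v → subst₂ Fin._<_ (sym (lookup-ε u)) (sym (lookup-ε v))
        (conjugate-lexicographic-increasing (lookup σ) cyclic prim u v bu≡bv u<v)

    δ-ε : δ (ε σ) ≡ σ
    δ-ε = trans (tabulate-cong (conjugate-inverse lexicographic alternating refl refl (lookup σ) (lookup (ε σ))
      cyclic prim lookup-ε (decreasing⇒alternating-mono prim decr))) (tabulate∘lookup σ)

proposition3p13 : (k n : ℕ) → 2 ≤ k → 1 ≤ n → n % 4 ≢ 2 →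
    (d : Fin (suc k) → ℕ) → d Fin.zero ≡ 0 → d (Fin.fromℕ k) ≡ n → StrictIncr d →
    Σ (Vec (Fin n) n → Vec (Fin n) n) λ δ →
      (∀ τ → IsCyclic τ → DesIn d τ →
        ∀ π → IsPerm π → IsHat π τ → ∀ s → Coding d π s →
        ∃ λ π' → IsΠ s π' × IsHat π' (δ τ))
      × (∀ τ → IsCyclic τ → DesIn d τ → IsCyclic (δ τ) × AscIn d (δ τ))
      × (∀ τ τ' → IsCyclic τ → DesIn d τ → IsCyclic τ' → DesIn d τ' →
          δ τ ≡ δ τ' → τ ≡ τ')
      × (∀ σ → IsCyclic σ → AscIn d σ →
          ∃ λ τ → IsCyclic τ × DesIn d τ × δ τ ≡ σ)
proposition3p13 k (suc m) _ _ n%4≢2 d d0 dk d-increasing =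
  δ , δ-pattern , δ-cyclic-ascIn ,
  (λ τ τ′ cyc des cyc′ des′ δτ≡δτ′ →
    trans (sym (ε-δ τ cyc des)) (trans (cong ε δτ≡δτ′) (ε-δ τ′ cyc′ des′))) ,
  (λ σ cyc asc → ε σ , ε-cyclic σ cyc asc n%4≢2 , ε-desIn σ cyc asc n%4≢2 , δ-ε σ cyc asc n%4≢2)
  where open Correspondence k m d d0 dk d-increasing
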